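{- Let $n\ge3$, $A\in\mathcal{PC}_n^0$ and $\tau\in\Gamma(A)$. Then: (1) For each $k\in N$, there is $w\in\mathcal{E}_\tau(A)$ such that $P_{A,\tau}[S_k^{(\tau)}]=W[S_k^{(\tau)}]$, where $W=ww^{(-T)}$. Namely, listing $\tau=\tau_1\tau_2\cdots\tau_n\tau_1$ with $\tau_1=k$, one may take $w$ to be the (projectively unique) positive solution of \[ w_{\tau_1}=P_{A,\tau}(\tau_1,\tau_2)w_{\tau_2}=P_{A,\tau}(\tau_1,\tau_3)w_{\tau_3}=\cdots=P_{A,\tau}(\tau_1,\tau_n)w_{\tau_n}, \] i.e. the inequalities defining $\mathcal{E}_\tau(A)$ all hold with equality except the one relating $k$ and the index adjacently preceding it in $\tau$; this $w$ spans an extreme ray of the convex cone $\mathcal{E}_\tau(A)$. (2) If $w\in\mathcal{E}_\tau(A)$ and $P_{A,\tau}[S]=W[S]$ for some nonempty $S\subseteq\mathcal{N}$, where $W=ww^{(-T)}$, then there is $k\in N$ such that $S\subseteq S_k^{(\tau)}$.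
   Context: Let $N=\{1,\dots,n\}$ and $\mathcal{N}=\{(x,y)\in N\times N: x\ne y\}$. A matrix $A=[a_{ij}]$ is reciprocal if its entries are positive and $a_{ji}=1/a_{ij}$; $\mathcal{PC}_n$ is the set of $n\times n$ reciprocal matrices; $A$ is consistent if $a_{ij}a_{jk}=a_{ik}$ for all $i,j,k$; $\mathcal{PC}_n^0$ is the set of non-consistent matrices in $\mathcal{PC}_n$. For $w\in\mathbb{R}^n_+$ (positive vectors), $ww^{(-T)}=[w_i/w_j]$. A Hamiltonian cycle (H-cycle) in $N$ is a cyclic sequence $\tau=\tau_1\cdots\tau_n\tau_1$ with $\tau_1\cdots\tau_n$ a permutation of $N$, which may be listed starting at any index. $\tau(A)=a_{\tau_1\tau_2}\cdots a_{\tau_{n-1}\tau_n}a_{\tau_n\tau_1}$; $\Gamma(A)$ is the set of H-cycles with $\tau(A)<1$. For $i\ne j$, listing $\tau$ with $\tau_1=i$ and $\tau_k=j$, $P_{A,\tau}(i,j)=a_{\tau_1\tau_2}\cdots a_{\tau_{k-1}\tau_k}$; the path matrix $P_{A,\tau}$ has diagonal entries $1$ and $(i,j)$ entry $P_{A,\tau}(i,j)$ for $i\ne j$. For $\tau\in\Gamma(A)$, $\mathcal{E}_\tau(A)=\{w\in\mathbb{R}^n_+: w_{\tau_1}\ge P_{A,\tau}(\tau_1,\tau_2)w_{\tau_2}\ge\cdots\ge P_{A,\tau}(\tau_1,\tau_n)w_{\tau_n}\ge \tau(A)w_{\tau_1}\}$ (this set does not depend on the index at which $\tau$ is listed). For an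 H-cycle $\tau$ and $k\in N$, list $\tau=\tau_1\cdots\tau_n\tau_1$ with $\tau_1=k$ and let $S_k^{(\tau)}=\{(\tau_i,\tau_j):1\le i<j\le n\}$. For a matrix $M$ and $S\subseteq N\times N$, $M[S]$ denotes the collection of entries of $M$ indexed by $S$, and $M[S]=M'[S]$ means the entries agree in every position of $S$. -}

module Defs where

open import Level using (Level; _⊔_) renaming (suc to lsuc)
open import Data.Nat using (ℕ; zero; suc)
import Data.Nat as ℕ
open import Data.Nat.DivMod using (_%_; m%n<n)
open import Data.Fin using (Fin; toℕ; fromℕ<)
import Data.Fin
open import Data.Fin.Permutation using (Permutation′; _⟨$⟩ʳ_; _⟨$⟩ˡ_)
open import Data.Product using (Σ; ∃; _×_; _,_)
open import Data.Sum using (_⊎_)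
open import Relation.Nullary using (¬_)
open import Relation.Binary.Core using (Rel)
open import Relation.Binary.Structures using (IsStrictTotalOrder)
open import Relation.Binary.PropositionalEquality using (_≡_)
open import Algebra.Bundles using (CommutativeRing)

-- Ordered fields.  The paper works over ℝ; agda-stdlib has no reals, so
-- we work over an arbitrary ordered field (ℝ is one).

record OrderedField (c ℓ₁ ℓ₂ : Level) : Set (lsuc (c ⊔ ℓ₁ ⊔ ℓ₂)) where
  field
    commutativeRing : CommutativeRing c ℓ₁
  open CommutativeRing commutativeRing public
  infix 4 _<ᶠ_ _≤ᶠ_
  field
    _<ᶠ_               : Rel Carrier ℓ₂
    isStrictTotalOrder : IsStrictTotalOrder _≈_ _<ᶠ_
    0<1                : 0# <ᶠ 1#
    +-mono-<           : ∀ {a b} c → a <ᶠ b → a + c <ᶠ b + c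
    *-pos              : ∀ {a b} → 0# <ᶠ a → 0# <ᶠ b → 0# <ᶠ a * b
    inverse            : ∀ a → ¬ (a ≈ 0#) → Σ Carrier λ b → a * b ≈ 1#

  _≤ᶠ_ : Rel Carrier (ℓ₁ ⊔ ℓ₂)
  a ≤ᶠ b = a <ᶠ b ⊎ a ≈ b

module PC {c ℓ₁ ℓ₂} (F : OrderedField c ℓ₁ ℓ₂) (m : ℕ) where
  open OrderedField F

  n : ℕ
  n = suc (suc (suc m))

  Matrix : Set c
  Matrix = Fin n → Fin n → Carrier

  Vector : Set c
  Vector = Fin n → Carrier

  Reciprocal : Matrix → Set (ℓ₁ ⊔ ℓ₂)
  Reciprocal A = (∀ i j → 0# <ᶠ A i j) × (∀ i j → A j i * A i j ≈ 1#)

  Consistent : Matrix → Set ℓ₁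
  Consistent A = ∀ i j k → A i j * A j k ≈ A i k

  NonConsistentPC : Matrix → Set (ℓ₁ ⊔ ℓ₂)
  NonConsistentPC A = Reciprocal A × ¬ Consistent A

  Positive : Vector → Set ℓ₂
  Positive w = ∀ i → 0# <ᶠ w i

  -- An H-cycle τ is given by one of its listings τ₁ τ₂ ⋯ τₙ τ₁, i.e. a
  -- permutation (position ↦ vertex).  Every notion below is invariant
  -- under cyclic relisting.
  HCycle : Set
  HCycle = Permutation′ n

  module _ (τ : HCycle) where
    pos : Fin n → Fin n
    pos v = τ ⟨$⟩ˡ v

    -- the t-th vertex (t = 0,1,2,…, cyclically) of the listing of τ
    -- starting at k; so L k 0 = k, L k n = k.
    L : Fin n → ℕ → Fin n
    L k t = τ ⟨$⟩ʳ fromℕ< (m%n<n (toℕ (pos k) ℕ.+ t) n)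

    -- offset of j after k along τ (the index t < n with L k t = j)
    off : Fin n → Fin n → ℕ
    off k j = ((toℕ (pos j) ℕ.+ n) ℕ.∸ toℕ (pos k)) % n

    pathFrom : Matrix → Fin n → ℕ → Carrier
    pathFrom A k zero    = 1#
    pathFrom A k (suc t) = pathFrom A k t * A (L k t) (L k (suc t))

    P : Matrix → Matrix
    P A i j = pathFrom A i (off i j)

    cycleVal : Matrix → Carrier
    cycleVal A = pathFrom A (τ ⟨$⟩ʳ Data.Fin.zero) n

    InΓ : Matrix → Set ℓ₂
    InΓ A = cycleVal A <ᶠ 1#

    -- w ∈ E_τ(A): with τ₁ the first vertex of the listing,
    --   w_{τ₁} ≥ P(τ₁,τ₂) w_{τ₂} ≥ ⋯ ≥ P(τ₁,τₙ) w_{τₙ} ≥ τ(A) w_{τ₁}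
    InE : Matrix → Vector → Set (ℓ₁ ⊔ ℓ₂)
    InE A w = Positive w × (∀ t → t ℕ.< n → q (suc t) ≤ᶠ q t)
      where
        τ₁ : Fin n
        τ₁ = τ ⟨$⟩ʳ Data.Fin.zero
        -- q t = P(τ₁,τ_{t+1}) w_{τ_{t+1}} for t < n, and q n = τ(A) w_{τ₁}
        q : ℕ → Carrier
        q t = pathFrom A τ₁ t * w (L τ₁ t)

    -- S_k^{(τ)} = {(τ_i, τ_j) : 1 ≤ i < j ≤ n} for the listing with τ₁ = k
    S : Fin n → Fin n → Fin n → Set
    S k i j = off k i ℕ.< off k j

  -- P_{A,τ}[S] = W[S] with W = w w^(-T), i.e. P(i,j) = w_i / w_j on S
  Agree : Matrix → Vector → (Fin n → Fin n → Set) → Set ℓ₁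
  Agree M w T = ∀ i j → T i j → M i j * w j ≈ w i

  ExtremeRay : (Vector → Set (ℓ₁ ⊔ ℓ₂)) → Vector → Set (c ⊔ ℓ₁ ⊔ ℓ₂)
  ExtremeRay E w = E w × (∀ u v → E u → E v → (∀ i → w i ≈ u i + v i) →
                           Σ Carrier λ λ' → ∀ i → u i ≈ λ' * w i)

-- Fix a positive vector w. Its potential from a vertex x along τ is t ↦ P(x, x + t) · w(x + t),
-- where x + t is the t-th successor of x on τ. Each step of the potential is one edge inequality
-- a(y, y⁺) · w(y⁺) ≤ w(y) multiplied by a positive factor, so w ∈ E_τ(A) exactly when all potentials
-- are antitone; and a full turn multiplies the potential by τ(A) < 1.
-- (1) For w(j) = 1 / P(k, j) the potential from k is constantly 1 before the turn, so all edges but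
-- the one entering k are tight and P agrees with w w^(-T) on S_k. If w = u + v in E_τ(A), both
-- potentials of u and v are antitone with constant sum, hence constant, which forces u ∝ w.
-- (2) Since the potential drops over a full turn, some edge x → x⁺ is strict. An agreement
-- P(i, j) · w(j) = w(i) says the potential from i is level up to j, so the arc from i to j avoids
-- that edge, i.e. (i, j) ∈ S_k for k = x⁺.

module Submission where

open import Defs
open import Data.Nat using (ℕ)
open import Data.Fin using (Fin)
import Data.Fin
open import Data.Product using (Σ; _×_; _,_; proj₁; proj₂)
open import Data.Sum using (inj₁; inj₂)
open import Data.Empty using (⊥-elim)
open import Relation.Nullary using (¬_; contradiction)
open import Relation.Binary.PropositionalEquality using (_≡_)
open import Relation.Binary.Definitions using (tri<; tri≈; tri>)
open import Relation.Binary.Bundles using (StrictPartialOrder)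
open import Relation.Binary.Structures using (IsStrictTotalOrder)

module OrderedFieldProperties {c ℓ₁ ℓ₂} (F : OrderedField c ℓ₁ ℓ₂) where
  open OrderedField F
  open IsStrictTotalOrder isStrictTotalOrder
    using (compare; irrefl; asym; <-respˡ-≈; isStrictPartialOrder)

  strictPartialOrder : StrictPartialOrder c ℓ₁ ℓ₂
  strictPartialOrder = record { isStrictPartialOrder = isStrictPartialOrder }

  open import Relation.Binary.Reasoning.StrictPartialOrder strictPartialOrder public

  <⇒≉ : ∀ {a b} → a <ᶠ b → ¬ (a ≈ b)
  <⇒≉ a<b a≈b = irrefl a≈b a<b

  *-monoʳ-<-pos : ∀ {a x y} → 0# <ᶠ a → x <ᶠ y → a * x <ᶠ a * y
  *-monoʳ-<-pos {a} {x} {y} 0<a x<y = begin-strict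
    a * x                ≈⟨ +-identityˡ (a * x) ⟨
    0# + a * x           <⟨ +-mono-< (a * x) (*-pos 0<a 0<y-x) ⟩
    a * (y - x) + a * x  ≈⟨ distrib-cancel ⟩
    a * y                ∎
    where
      0<y-x : 0# <ᶠ y - x
      0<y-x = <-respˡ-≈ (-‿inverseʳ x) (+-mono-< (- x) x<y)
      distrib-cancel : a * (y - x) + a * x ≈ a * y
      distrib-cancel = begin-equality
        a * (y - x) + a * x  ≈⟨ distribˡ a (y - x) x ⟨
        a * ((y - x) + x)    ≈⟨ *-congˡ (+-assoc y (- x) x) ⟩
        a * (y + (- x + x))  ≈⟨ *-congˡ (+-congˡ (-‿inverseˡ x)) ⟩
        a * (y + 0#)         ≈⟨ *-congˡ (+-identityʳ y) ⟩
        a * y                ∎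

  *-monoˡ-<-pos : ∀ {a x y} → 0# <ᶠ a → x <ᶠ y → x * a <ᶠ y * a
  *-monoˡ-<-pos {a} {x} {y} 0<a x<y = begin-strict
    x * a  ≈⟨ *-comm x a ⟩
    a * x  <⟨ *-monoʳ-<-pos 0<a x<y ⟩
    a * y  ≈⟨ *-comm a y ⟩
    y * a  ∎

  *-monoʳ-≤-pos : ∀ {a x y} → 0# <ᶠ a → x ≤ᶠ y → a * x ≤ᶠ a * y
  *-monoʳ-≤-pos 0<a (inj₁ x<y) = inj₁ (*-monoʳ-<-pos 0<a x<y)
  *-monoʳ-≤-pos 0<a (inj₂ x≈y) = inj₂ (*-congˡ x≈y)

  *-cancelˡ-≈-pos : ∀ {a x y} → 0# <ᶠ a → a * x ≈ a * y → x ≈ y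
  *-cancelˡ-≈-pos {a} {x} {y} 0<a ax≈ay with compare x y
  ... | tri< x<y _ _ = contradiction ax≈ay (<⇒≉ (*-monoʳ-<-pos 0<a x<y))
  ... | tri≈ _ x≈y _ = x≈y
  ... | tri> _ _ y<x = contradiction (sym ax≈ay) (<⇒≉ (*-monoʳ-<-pos 0<a y<x))

  *-cancelˡ-<-pos : ∀ {a x y} → 0# <ᶠ a → a * x <ᶠ a * y → x <ᶠ y
  *-cancelˡ-<-pos {a} {x} {y} 0<a ax<ay with compare x y
  ... | tri< x<y _ _ = x<y
  ... | tri≈ _ x≈y _ = contradiction (*-congˡ x≈y) (<⇒≉ ax<ay)
  ... | tri> _ _ y<x = ⊥-elim (asym ax<ay (*-monoʳ-<-pos 0<a y<x))

  *-cancelˡ-≤-pos : ∀ {a x y} → 0# <ᶠ a → a * x ≤ᶠ a * y → x ≤ᶠ y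
  *-cancelˡ-≤-pos 0<a (inj₁ ax<ay) = inj₁ (*-cancelˡ-<-pos 0<a ax<ay)
  *-cancelˡ-≤-pos 0<a (inj₂ ax≈ay) = inj₂ (*-cancelˡ-≈-pos 0<a ax≈ay)

  +-mono-<-≤ : ∀ {a b x y} → a <ᶠ b → x ≤ᶠ y → a + x <ᶠ b + y
  +-mono-<-≤ {a} {b} {x} {y} a<b x≤y = begin-strict
    a + x   <⟨ +-mono-< x a<b ⟩
    b + x   ≈⟨ +-comm b x ⟩
    x + b   ≤⟨ +-monoʳ-≤ x≤y ⟩
    y + b   ≈⟨ +-comm y b ⟩
    b + y   ∎
    where
      +-monoʳ-≤ : x ≤ᶠ y → x + b ≤ᶠ y + b
      +-monoʳ-≤ (inj₁ x<y) = inj₁ (+-mono-< b x<y)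
      +-monoʳ-≤ (inj₂ x≈y) = inj₂ (+-congʳ x≈y)

  +-≤-≈⇒≈ : ∀ {a′ a b′ b} → a′ ≤ᶠ a → b′ ≤ᶠ b → a′ + b′ ≈ a + b → a′ ≈ a
  +-≤-≈⇒≈ (inj₁ a′<a) b′≤b sum≈ = contradiction sum≈ (<⇒≉ (+-mono-<-≤ a′<a b′≤b))
  +-≤-≈⇒≈ (inj₂ a′≈a) _    _    = a′≈a

  positiveInverse : ∀ {a} → 0# <ᶠ a → Σ Carrier λ b → 0# <ᶠ b × a * b ≈ 1#
  positiveInverse {a} 0<a with inverse a (λ a≈0 → <⇒≉ 0<a (sym a≈0))
  ... | b , ab≈1 with compare 0# b
  ...   | tri< 0<b _ _ = b , 0<b , ab≈1
  ...   | tri≈ _ 0≈b _ = contradiction (begin-equality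
                           0#      ≈⟨ zeroʳ a ⟨
                           a * 0#  ≈⟨ *-congˡ 0≈b ⟩
                           a * b   ≈⟨ ab≈1 ⟩
                           1#      ∎) (<⇒≉ 0<1)
  ...   | tri> _ _ b<0 = ⊥-elim (asym 0<1 (begin-strict
                           1#      ≈⟨ ab≈1 ⟨
                           a * b   <⟨ *-monoʳ-<-pos 0<a b<0 ⟩
                           a * 0#  ≈⟨ zeroʳ a ⟩
                           0#      ∎))

  solve-by-inverse : ∀ {p q x y} → p * q ≈ 1# → p * x ≈ y → x ≈ y * q
  solve-by-inverse {p} {q} {x} {y} pq≈1 px≈y = begin-equality
    x             ≈⟨ *-identityʳ x ⟨
    x * 1#        ≈⟨ *-congˡ pq≈1 ⟨
    x * (p * q)   ≈⟨ *-assoc x p q ⟨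
    x * p * q     ≈⟨ *-congʳ (*-comm x p) ⟩
    p * x * q     ≈⟨ *-congʳ px≈y ⟩
    y * q         ∎

module CycleArithmetic {c ℓ₁ ℓ₂} (F : OrderedField c ℓ₁ ℓ₂) (m : ℕ) (τ : PC.HCycle F m) where
  open PC F m
  open import Data.Nat using (suc; _+_; _∸_; _<_; _≤_; s≤s⁻¹)
  open import Data.Nat.Properties
  open import Data.Nat.DivMod using (_%_; m%n<n; %-distribˡ-+; m%n%n≡m%n; [m+n]%n≡m%n; m<n⇒m%n≡m)
  open import Data.Fin using (toℕ; fromℕ<)
  open import Data.Fin.Permutation using (_⟨$⟩ʳ_; inverseˡ; inverseʳ)
  open import Data.Fin.Properties using (toℕ-injective; toℕ<n; toℕ-fromℕ<; fromℕ<-cong)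
  open import Relation.Binary.PropositionalEquality
  open ≡-Reasoning

  position : Fin n → ℕ
  position x = toℕ (pos τ x)

  vertexAt : ℕ → Fin n
  vertexAt a = τ ⟨$⟩ʳ fromℕ< (m%n<n a n)

  position<n : ∀ x → position x < n
  position<n x = toℕ<n (pos τ x)

  vertexAt-cong : ∀ a b → a % n ≡ b % n → vertexAt a ≡ vertexAt b
  vertexAt-cong a b eq = cong (τ ⟨$⟩ʳ_) (fromℕ<-cong _ _ eq (m%n<n a n) (m%n<n b n))

  position-vertexAt : ∀ a → position (vertexAt a) ≡ a % n
  position-vertexAt a = trans (cong toℕ (inverseˡ τ)) (toℕ-fromℕ< (m%n<n a n))

  vertexAt-position : ∀ x → vertexAt (position x) ≡ x
  vertexAt-position x = trans
    (cong (τ ⟨$⟩ʳ_) (toℕ-injective (trans (toℕ-fromℕ< _) (m<n⇒m%n≡m (position<n x)))))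
    (inverseʳ τ)

  %-absorbˡ-+ : ∀ a b → (a % n + b) % n ≡ (a + b) % n
  %-absorbˡ-+ a b = begin
    (a % n + b) % n          ≡⟨ %-distribˡ-+ (a % n) b n ⟩
    (a % n % n + b % n) % n  ≡⟨ cong (λ r → (r + b % n) % n) (m%n%n≡m%n a n) ⟩
    (a % n + b % n) % n      ≡⟨ %-distribˡ-+ a b n ⟨
    (a + b) % n              ∎

  L-zero : ∀ x → L τ x 0 ≡ x
  L-zero x = trans (cong vertexAt (+-identityʳ (position x))) (vertexAt-position x)

  L-+ : ∀ x t u → L τ (L τ x t) u ≡ L τ x (t + u)
  L-+ x t u = vertexAt-cong (position (L τ x t) + u) (position x + (t + u)) (begin
    (position (L τ x t) + u) % n   ≡⟨ cong (λ r → (r + u) % n) (position-vertexAt (position x + t)) ⟩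
    ((position x + t) % n + u) % n ≡⟨ %-absorbˡ-+ (position x + t) u ⟩
    (position x + t + u) % n       ≡⟨ cong (_% n) (+-assoc (position x) t u) ⟩
    (position x + (t + u)) % n     ∎)

  L-period : ∀ x → L τ x n ≡ x
  L-period x = trans (vertexAt-cong (position x + n) (position x) ([m+n]%n≡m%n (position x) n))
                     (vertexAt-position x)

  off<n : ∀ x y → off τ x y < n
  off<n x y = m%n<n ((position y + n) ∸ position x) n

  L-off : ∀ x y → L τ x (off τ x y) ≡ y
  L-off x y = trans (vertexAt-cong (position x + off τ x y) (position y) eq) (vertexAt-position y)
    where
      p = position x
      q = position y
      eq : (p + ((q + n) ∸ p) % n) % n ≡ q % n
      eq = begin
        (p + ((q + n) ∸ p) % n) % n  ≡⟨ cong (_% n) (+-comm p _) ⟩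
        (((q + n) ∸ p) % n + p) % n  ≡⟨ %-absorbˡ-+ ((q + n) ∸ p) p ⟩
        ((q + n) ∸ p + p) % n        ≡⟨ cong (_% n) (m∸n+n≡m (≤-trans (<⇒≤ (position<n x)) (m≤n+m n q))) ⟩
        (q + n) % n                  ≡⟨ [m+n]%n≡m%n q n ⟩
        q % n                        ∎

  L-injective : ∀ x {s t} → s < n → t < n → L τ x s ≡ L τ x t → s ≡ t
  L-injective x {s} {t} s<n t<n eq = begin
    s                              ≡⟨ rotate-back s s<n ⟨
    ((p + s) % n + (n ∸ p)) % n    ≡⟨ cong (λ r → (r + (n ∸ p)) % n) same ⟩
    ((p + t) % n + (n ∸ p)) % n    ≡⟨ rotate-back t t<n ⟩
    t                              ∎
    where
      p = position x
      same : (p + s) % n ≡ (p + t) % n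
      same = trans (sym (position-vertexAt (p + s))) (trans (cong position eq) (position-vertexAt (p + t)))
      rotate-back : ∀ a → a < n → ((p + a) % n + (n ∸ p)) % n ≡ a
      rotate-back a a<n = begin
        ((p + a) % n + (n ∸ p)) % n  ≡⟨ %-absorbˡ-+ (p + a) (n ∸ p) ⟩
        (p + a + (n ∸ p)) % n        ≡⟨ cong (λ r → (r + (n ∸ p)) % n) (+-comm p a) ⟩
        (a + p + (n ∸ p)) % n        ≡⟨ cong (_% n) (+-assoc a p (n ∸ p)) ⟩
        (a + (p + (n ∸ p))) % n      ≡⟨ cong (λ r → (a + r) % n) (m+[n∸m]≡n (<⇒≤ (position<n x))) ⟩
        (a + n) % n                  ≡⟨ [m+n]%n≡m%n a n ⟩
        a % n                        ≡⟨ m<n⇒m%n≡m a<n ⟩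
        a                            ∎

  off-L : ∀ x {t} → t < n → off τ x (L τ x t) ≡ t
  off-L x t<n = L-injective x (off<n x _) t<n (L-off x _)

  next : Fin n → Fin n
  next y = L τ y 1

  next-L : ∀ x t → next (L τ x t) ≡ L τ x (suc t)
  next-L x t = trans (L-+ x t 1) (cong (L τ x) (+-comm t 1))

  L-off-+ : ∀ k i e → L τ k (off τ k i + e) ≡ L τ i e
  L-off-+ k i e = trans (sym (L-+ k (off τ k i) e)) (cong (λ x → L τ x e) (L-off k i))

  off-∸ : ∀ k i j → off τ k i ≤ off τ k j → off τ i j ≡ off τ k j ∸ off τ k i
  off-∸ k i j ci≤cj = trans (cong (off τ i) j≡) (off-L i (≤-<-trans (m∸n≤m cj ci) (off<n k j)))
    where
      ci = off τ k i
      cj = off τ k j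
      j≡ : j ≡ L τ i (cj ∸ ci)
      j≡ = begin
        j                      ≡⟨ L-off k j ⟨
        L τ k cj               ≡⟨ cong (L τ k) (m+[n∸m]≡n ci≤cj) ⟨
        L τ k (ci + (cj ∸ ci)) ≡⟨ L-off-+ k i (cj ∸ ci) ⟩
        L τ i (cj ∸ ci)        ∎

  off-+ : ∀ k i j → off τ k i + off τ i j < n → off τ k j ≡ off τ k i + off τ i j
  off-+ k i j sum<n =
    trans (cong (off τ k) (sym (trans (L-off-+ k i (off τ i j)) (L-off i j)))) (off-L k sum<n)

  off-positive : ∀ {i j} → i ≢ j → 0 < off τ i j
  off-positive {i} {j} i≢j = n≢0⇒n>0 λ d≡0 → i≢j (begin
    i                   ≡⟨ L-zero i ⟨
    L τ i 0             ≡⟨ cong (L τ i) d≡0 ⟨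
    L τ i (off τ i j)   ≡⟨ L-off i j ⟩
    j                   ∎)

  arc-through-predecessor : ∀ x i j → i ≢ j → off τ (next x) j ≤ off τ (next x) i →
                            Σ ℕ λ s → s < off τ i j × L τ i s ≡ x
  arc-through-predecessor x i j i≢j cj≤ci = s , s<d , L-i-s
    where
      k = next x
      ci = off τ k i
      d = off τ i j
      s = suc (suc m) ∸ ci
      ci+s≡n-1 : ci + s ≡ suc (suc m)
      ci+s≡n-1 = m+[n∸m]≡n (s≤s⁻¹ (off<n k i))
      -- otherwise j would be reached from k after i, at offset ci + d
      n≤ci+d : n ≤ ci + d
      n≤ci+d = ≮⇒≥ λ ci+d<n →
        <⇒≱ (<-≤-trans (m<m+n ci (off-positive i≢j)) (≤-reflexive (sym (off-+ k i j ci+d<n)))) cj≤ci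
      s<d : s < d
      s<d = +-cancelˡ-≤ ci (suc s) d (≤-trans (≤-reflexive (trans (+-suc ci s) (cong suc ci+s≡n-1))) n≤ci+d)
      L-i-s : L τ i s ≡ x
      L-i-s = begin
        L τ i s              ≡⟨ L-off-+ k i s ⟨
        L τ k (ci + s)       ≡⟨ cong (L τ k) ci+s≡n-1 ⟩
        L τ k (suc (suc m))  ≡⟨ L-+ x 1 (suc (suc m)) ⟩
        L τ x n              ≡⟨ L-period x ⟩
        x                    ∎

module CyclePotential {c ℓ₁ ℓ₂} (F : OrderedField c ℓ₁ ℓ₂) (m : ℕ) where
  open OrderedField F
  open OrderedFieldProperties F
  open PC F m
  open import Level using (_⊔_)
  open import Data.Nat using (zero; suc)
  open import Data.Sum using (_⊎_)
  import Data.Nat as ℕ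
  import Data.Nat.Properties as ℕₚ
  open import Data.Fin.Permutation using (_⟨$⟩ʳ_)
  import Relation.Binary.PropositionalEquality as ≡
  open ≡ using (_≢_)
  open import Relation.Nullary using (yes; no)

  module Along (τ : HCycle) (A : Matrix) (A-pos : ∀ i j → 0# <ᶠ A i j) where
    open CycleArithmetic F m τ

    pathFrom-pos : ∀ x t → 0# <ᶠ pathFrom τ A x t
    pathFrom-pos x zero    = 0<1
    pathFrom-pos x (suc t) = *-pos (pathFrom-pos x t) (A-pos _ _)

    pathFrom-+ : ∀ x a b → pathFrom τ A x (a ℕ.+ b) ≈ pathFrom τ A x a * pathFrom τ A (L τ x a) b
    pathFrom-+ x a zero = begin-equality
      pathFrom τ A x (a ℕ.+ 0)  ≡⟨ ≡.cong (pathFrom τ A x) (ℕₚ.+-identityʳ a) ⟩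
      pathFrom τ A x a          ≈⟨ *-identityʳ _ ⟨
      pathFrom τ A x a * 1#     ∎
    pathFrom-+ x a (suc b) = begin-equality
      pathFrom τ A x (a ℕ.+ suc b)                  ≡⟨ ≡.cong (pathFrom τ A x) (ℕₚ.+-suc a b) ⟩
      pathFrom τ A x (a ℕ.+ b) * edge               ≈⟨ *-congʳ (pathFrom-+ x a b) ⟩
      pathFrom τ A x a * pathFrom τ A y b * edge    ≈⟨ *-assoc _ _ _ ⟩
      pathFrom τ A x a * (pathFrom τ A y b * edge)  ≡⟨ ≡.cong (λ e → pathFrom τ A x a * (pathFrom τ A y b * e))
                                                                same-edge ⟩
      pathFrom τ A x a * pathFrom τ A y (suc b)     ∎
      where
        y = L τ x a
        edge : Carrier
        edge = A (L τ x (a ℕ.+ b)) (L τ x (suc (a ℕ.+ b)))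
        same-edge : edge ≡ A (L τ y b) (L τ y (suc b))
        same-edge = ≡.cong₂ A (≡.sym (L-+ x a b))
                              (≡.trans (≡.cong (L τ x) (≡.sym (ℕₚ.+-suc a b))) (≡.sym (L-+ x a (suc b))))

    pathFrom-off-+ : ∀ k i b → pathFrom τ A k (off τ k i ℕ.+ b) ≈ P τ A k i * pathFrom τ A i b
    pathFrom-off-+ k i b = ≡.subst (λ y → pathFrom τ A k (off τ k i ℕ.+ b) ≈ P τ A k i * pathFrom τ A y b)
                                   (L-off k i) (pathFrom-+ k (off τ k i) b)

    pathFrom-period : ∀ x → pathFrom τ A x n ≈ cycleVal τ A
    pathFrom-period x = *-cancelˡ-≈-pos (pathFrom-pos τ₁ o) (begin-equality
      P τ A τ₁ x * pathFrom τ A x n             ≈⟨ pathFrom-off-+ τ₁ x n ⟨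
      pathFrom τ A τ₁ (o ℕ.+ n)                 ≡⟨ ≡.cong (pathFrom τ A τ₁) (ℕₚ.+-comm o n) ⟩
      pathFrom τ A τ₁ (n ℕ.+ o)                 ≈⟨ pathFrom-+ τ₁ n o ⟩
      cycleVal τ A * pathFrom τ A (L τ τ₁ n) o  ≡⟨ ≡.cong (λ y → cycleVal τ A * pathFrom τ A y o)
                                                            (L-period τ₁) ⟩
      cycleVal τ A * P τ A τ₁ x                 ≈⟨ *-comm _ _ ⟩
      P τ A τ₁ x * cycleVal τ A                 ∎)
      where
        τ₁ = τ ⟨$⟩ʳ Data.Fin.zero
        o = off τ τ₁ x

    -- For x = τ₁ this is the sequence whose antitonicity defines InE.
    potential : Vector → Fin n → ℕ → Carrier
    potential w x t = pathFrom τ A x t * w (L τ x t)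

    forward : Vector → Fin n → Carrier
    forward w y = A y (next y) * w (next y)

    EdgeBounded : Vector → Set (ℓ₁ ⊔ ℓ₂)
    EdgeBounded w = ∀ y → forward w y ≤ᶠ w y

    StrictEdge : Vector → Set ℓ₂
    StrictEdge w = Σ (Fin n) λ y → forward w y <ᶠ w y

    potential-zero : ∀ w x → potential w x 0 ≈ w x
    potential-zero w x = trans (*-identityˡ _) (reflexive (≡.cong w (L-zero x)))

    potential-off : ∀ w i j → potential w i (off τ i j) ≈ P τ A i j * w j
    potential-off w i j = reflexive (≡.cong (λ y → P τ A i j * w y) (L-off i j))

    potential-suc : ∀ w x t → potential w x (suc t) ≈ pathFrom τ A x t * forward w (L τ x t)
    potential-suc w x t = trans (*-assoc _ _ _)
      (reflexive (≡.cong (λ y → pathFrom τ A x t * (A (L τ x t) y * w y)) (≡.sym (next-L x t))))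

    potential-period : ∀ w x → potential w x n ≈ cycleVal τ A * potential w x 0
    potential-period w x = begin-equality
      pathFrom τ A x n * w (L τ x n)  ≈⟨ *-cong (pathFrom-period x) (reflexive (≡.cong w (L-period x))) ⟩
      cycleVal τ A * w x              ≈⟨ *-congˡ (potential-zero w x) ⟨
      cycleVal τ A * potential w x 0  ∎

    potential-pos : ∀ {w} → Positive w → ∀ x t → 0# <ᶠ potential w x t
    potential-pos w-pos x t = *-pos (pathFrom-pos x t) (w-pos _)

    potential-+ : ∀ {u v w} → (∀ i → w i ≈ u i + v i) → ∀ x t →
                  potential w x t ≈ potential u x t + potential v x t
    potential-+ w≈u+v x t = trans (*-congˡ (w≈u+v _)) (distribˡ _ _ _)

    edge⇒step≤ : ∀ w x t → forward w (L τ x t) ≤ᶠ w (L τ x t) → potential w x (suc t) ≤ᶠ potential w x t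
    edge⇒step≤ w x t edge = begin
      potential w x (suc t)                   ≈⟨ potential-suc w x t ⟩
      pathFrom τ A x t * forward w (L τ x t)  ≤⟨ *-monoʳ-≤-pos (pathFrom-pos x t) edge ⟩
      potential w x t                         ∎

    edge⇒step< : ∀ w x t → forward w (L τ x t) <ᶠ w (L τ x t) → potential w x (suc t) <ᶠ potential w x t
    edge⇒step< w x t edge = begin-strict
      potential w x (suc t)                   ≈⟨ potential-suc w x t ⟩
      pathFrom τ A x t * forward w (L τ x t)  <⟨ *-monoʳ-<-pos (pathFrom-pos x t) edge ⟩
      potential w x t                         ∎

    step≤⇒edge : ∀ w x t → potential w x (suc t) ≤ᶠ potential w x t → forward w (L τ x t) ≤ᶠ w (L τ x t)
    step≤⇒edge w x t step = *-cancelˡ-≤-pos (pathFrom-pos x t) (begin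
      pathFrom τ A x t * forward w (L τ x t)  ≈⟨ potential-suc w x t ⟨
      potential w x (suc t)                   ≤⟨ step ⟩
      potential w x t                         ∎)

    steps⇒EdgeBounded : ∀ {w} x → (∀ t → t ℕ.< n → potential w x (suc t) ≤ᶠ potential w x t) →
                        EdgeBounded w
    steps⇒EdgeBounded {w} x steps y = ≡.subst (λ z → forward w z ≤ᶠ w z) (L-off x y)
      (step≤⇒edge w x (off τ x y) (steps (off τ x y) (off<n x y)))

    InE⇒EdgeBounded : ∀ {w} → InE τ A w → EdgeBounded w
    InE⇒EdgeBounded (_ , steps) = steps⇒EdgeBounded _ steps

    EdgeBounded⇒InE : ∀ {w} → Positive w → EdgeBounded w → InE τ A w
    EdgeBounded⇒InE {w} w-pos bounded = w-pos , λ t _ → edge⇒step≤ w _ t (bounded _)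

    potential-antitone : ∀ {w} → EdgeBounded w → ∀ x s d → potential w x (s ℕ.+ d) ≤ᶠ potential w x s
    potential-antitone {w} bounded x s zero = begin
      potential w x (s ℕ.+ 0)        ≡⟨ ≡.cong (potential w x) (ℕₚ.+-identityʳ s) ⟩
      potential w x s                ∎
    potential-antitone {w} bounded x s (suc d) = begin
      potential w x (s ℕ.+ suc d)    ≡⟨ ≡.cong (potential w x) (ℕₚ.+-suc s d) ⟩
      potential w x (suc (s ℕ.+ d))  ≤⟨ edge⇒step≤ w x (s ℕ.+ d) (bounded _) ⟩
      potential w x (s ℕ.+ d)        ≤⟨ potential-antitone bounded x s d ⟩
      potential w x s                ∎

    potential-drops : ∀ {w} → EdgeBounded w → ∀ x {s d} → forward w (L τ x s) <ᶠ w (L τ x s) →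
                      s ℕ.< d → potential w x d <ᶠ potential w x 0
    potential-drops {w} bounded x {s} {d} drop s<d = begin-strict
      potential w x d                          ≡⟨ ≡.cong (potential w x) (ℕₚ.m+[n∸m]≡n s<d) ⟨
      potential w x (suc s ℕ.+ (d ℕ.∸ suc s))  ≤⟨ potential-antitone bounded x (suc s) (d ℕ.∸ suc s) ⟩
      potential w x (suc s)                    <⟨ edge⇒step< w x s drop ⟩
      potential w x s                          ≤⟨ potential-antitone bounded x 0 s ⟩
      potential w x 0                          ∎

    potential-period-< : ∀ {w} → InΓ τ A → Positive w → ∀ x → potential w x n <ᶠ potential w x 0
    potential-period-< {w} γ w-pos x = begin-strict
      potential w x n                 ≈⟨ potential-period w x ⟩
      cycleVal τ A * potential w x 0  <⟨ *-monoˡ-<-pos (potential-pos w-pos x 0) γ ⟩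
      1# * potential w x 0            ≈⟨ *-identityˡ _ ⟩
      potential w x 0                 ∎

    StrictEdge⊎level : ∀ {w} → EdgeBounded w → ∀ x t → StrictEdge w ⊎ potential w x t ≈ potential w x 0
    StrictEdge⊎level bounded x zero = inj₂ refl
    StrictEdge⊎level {w} bounded x (suc t) with StrictEdge⊎level bounded x t | bounded (L τ x t)
    ... | inj₁ drop  | _          = inj₁ drop
    ... | inj₂ _     | inj₁ drop  = inj₁ (L τ x t , drop)
    ... | inj₂ level | inj₂ tight = inj₂ (begin-equality
      potential w x (suc t)                   ≈⟨ potential-suc w x t ⟩
      pathFrom τ A x t * forward w (L τ x t)  ≈⟨ *-congˡ tight ⟩
      potential w x t                         ≈⟨ level ⟩
      potential w x 0                         ∎)

    strictEdge : ∀ {w} → InΓ τ A → InE τ A w → StrictEdge w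
    strictEdge γ w∈E@(w-pos , _) with StrictEdge⊎level (InE⇒EdgeBounded w∈E) Data.Fin.zero n
    ... | inj₁ drop  = drop
    ... | inj₂ level = contradiction level (<⇒≉ (potential-period-< γ w-pos _))

    agreement-ordered : ∀ {w} → InΓ τ A → InE τ A w →
                        Σ (Fin n) λ k → ∀ i j → i ≢ j → P τ A i j * w j ≈ w i → off τ k i ℕ.< off τ k j
    agreement-ordered {w} γ w∈E with strictEdge γ w∈E
    ... | x , drop = next x , ordered
      where
        ordered : ∀ i j → i ≢ j → P τ A i j * w j ≈ w i → off τ (next x) i ℕ.< off τ (next x) j
        ordered i j i≢j agree with off τ (next x) i ℕ.<? off τ (next x) j
        ... | yes before = before
        ... | no not-before with arc-through-predecessor x i j i≢j (ℕₚ.≮⇒≥ not-before)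
        ...   | s , s<d , L-i-s≡x =
          contradiction level (<⇒≉ (potential-drops (InE⇒EdgeBounded w∈E) i drop′ s<d))
          where
            drop′ : forward w (L τ i s) <ᶠ w (L τ i s)
            drop′ = ≡.subst (λ y → forward w y <ᶠ w y) (≡.sym L-i-s≡x) drop
            level : potential w i (off τ i j) ≈ potential w i 0
            level = trans (potential-off w i j) (trans agree (sym (potential-zero w i)))

    module _ (k : Fin n) where
      extremeVector : Vector
      extremeVector j = proj₁ (positiveInverse (pathFrom-pos k (off τ k j)))

      extremeVector-pos : Positive extremeVector
      extremeVector-pos j = proj₁ (proj₂ (positiveInverse (pathFrom-pos k (off τ k j))))

      P-extremeVector : ∀ j → P τ A k j * extremeVector j ≈ 1#
      P-extremeVector j = proj₂ (proj₂ (positiveInverse (pathFrom-pos k (off τ k j))))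

      extremeVector-potential : ∀ {t} → t ℕ.< n → potential extremeVector k t ≈ 1#
      extremeVector-potential {t} t<n = begin-equality
        pathFrom τ A k t * w (L τ k t)   ≡⟨ ≡.cong (λ d → pathFrom τ A k d * w (L τ k t)) (off-L k t<n) ⟨
        P τ A k (L τ k t) * w (L τ k t)  ≈⟨ P-extremeVector (L τ k t) ⟩
        1#                               ∎
        where w = extremeVector

      extremeVector-level : ∀ j → extremeVector k ≈ P τ A k j * extremeVector j
      extremeVector-level j = begin-equality
        extremeVector k              ≈⟨ potential-zero extremeVector k ⟨
        potential extremeVector k 0  ≈⟨ extremeVector-potential (ℕ.s≤s ℕ.z≤n) ⟩
        1#                           ≈⟨ P-extremeVector j ⟨
        P τ A k j * extremeVector j  ∎

      extremeVector-∈E : InΓ τ A → InE τ A extremeVector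
      extremeVector-∈E γ = EdgeBounded⇒InE extremeVector-pos (steps⇒EdgeBounded k step)
        where
          w = extremeVector
          step : ∀ t → t ℕ.< n → potential w k (suc t) ≤ᶠ potential w k t
          step t t<n with ℕₚ.m≤n⇒m<n∨m≡n t<n
          ... | inj₁ t+1<n = inj₂ (trans (extremeVector-potential t+1<n) (sym (extremeVector-potential t<n)))
          ... | inj₂ t+1≡n = begin
            potential w k (suc t)  ≡⟨ ≡.cong (potential w k) t+1≡n ⟩
            potential w k n        <⟨ potential-period-< γ extremeVector-pos k ⟩
            potential w k 0        ≈⟨ extremeVector-potential (ℕ.s≤s ℕ.z≤n) ⟩
            1#                     ≈⟨ extremeVector-potential t<n ⟨
            potential w k t        ∎

      extremeVector-agree : Agree (P τ A) extremeVector (S τ k)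
      extremeVector-agree i j ci<cj = *-cancelˡ-≈-pos (pathFrom-pos k (off τ k i)) (begin-equality
        P τ A k i * (P τ A i j * w j)              ≈⟨ *-assoc _ _ _ ⟨
        P τ A k i * P τ A i j * w j                ≈⟨ *-congʳ (pathFrom-off-+ k i (off τ i j)) ⟨
        pathFrom τ A k (off τ k i ℕ.+ off τ i j) * w j
                                                   ≡⟨ ≡.cong (λ d → pathFrom τ A k d * w j) ci+d≡cj ⟩
        P τ A k j * w j                            ≈⟨ P-extremeVector j ⟩
        1#                                         ≈⟨ P-extremeVector i ⟨
        P τ A k i * w i                            ∎)
        where
          w = extremeVector
          ci+d≡cj : off τ k i ℕ.+ off τ i j ≡ off τ k j
          ci+d≡cj = ≡.trans (≡.cong (off τ k i ℕ.+_) (off-∸ k i j (ℕₚ.<⇒≤ ci<cj)))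
                            (ℕₚ.m+[n∸m]≡n (ℕₚ.<⇒≤ ci<cj))

      proportional-to-extremeVector : ∀ (u : Vector) → (∀ j → P τ A k j * u j ≈ u k) →
                                      ∀ j → u j ≈ u k * extremeVector j
      proportional-to-extremeVector u level j = solve-by-inverse (P-extremeVector j) (level j)

      extremeVector-unique : ∀ w′ → Positive w′ → (∀ j → w′ k ≈ P τ A k j * w′ j) →
                             Σ Carrier λ λ′ → 0# <ᶠ λ′ × (∀ j → w′ j ≈ λ′ * extremeVector j)
      extremeVector-unique w′ w′-pos level =
        w′ k , w′-pos k , proportional-to-extremeVector w′ (λ j → sym (level j))

      extremeVector-summand-level : ∀ {u v} → InE τ A u → InE τ A v → (∀ i → extremeVector i ≈ u i + v i) →
                                    ∀ j → P τ A k j * u j ≈ u k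
      extremeVector-summand-level {u} {v} u∈E v∈E w≈u+v j = begin-equality
        P τ A k j * u j  ≈⟨ potential-off u k j ⟨
        potential u k t  ≈⟨ +-≤-≈⇒≈ (potential-antitone (InE⇒EdgeBounded u∈E) k 0 t)
                                     (potential-antitone (InE⇒EdgeBounded v∈E) k 0 t) sums-level ⟩
        potential u k 0  ≈⟨ potential-zero u k ⟩
        u k              ∎
        where
          w = extremeVector
          t = off τ k j
          sums-level : potential u k t + potential v k t ≈ potential u k 0 + potential v k 0
          sums-level = begin-equality
            potential u k t + potential v k t  ≈⟨ potential-+ w≈u+v k t ⟨
            potential w k t                    ≈⟨ extremeVector-potential (off<n k j) ⟩
            1#                                 ≈⟨ extremeVector-potential (ℕ.s≤s ℕ.z≤n) ⟨
            potential w k 0                    ≈⟨ potential-+ w≈u+v k 0 ⟩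
            potential u k 0 + potential v k 0  ∎

      extremeVector-extremeRay : InΓ τ A → ExtremeRay (InE τ A) extremeVector
      extremeVector-extremeRay γ = extremeVector-∈E γ , λ u v u∈E v∈E w≈u+v →
        u k , proportional-to-extremeVector u (extremeVector-summand-level u∈E v∈E w≈u+v)

theorem5p7 : ∀ {c ℓ₁ ℓ₂} (F : OrderedField c ℓ₁ ℓ₂) (m : ℕ) →
  let open OrderedField F
      open PC F m
  in (A : Matrix) (τ : HCycle) → NonConsistentPC A → InΓ τ A →
    -- (1)
    ((k : Fin n) → Σ Vector λ w →
        InE τ A w
      × Agree (P τ A) w (S τ k)
      × (∀ j → w k ≈ P τ A k j * w j)
      × (∀ w′ → Positive w′ → (∀ j → w′ k ≈ P τ A k j * w′ j) →
           Σ Carrier λ λ' → 0# <ᶠ λ' × (∀ i → w′ i ≈ λ' * w i))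
      × ExtremeRay (InE τ A) w)
    ×
    -- (2)
    ((w : Vector) → InE τ A w → (T : Fin n → Fin n → Set) →
        (∀ i j → T i j → ¬ (i ≡ j)) →
        Σ (Fin n) (λ i → Σ (Fin n) λ j → T i j) →
        Agree (P τ A) w T →
        Σ (Fin n) λ k → ∀ i j → T i j → S τ k i j)
theorem5p7 F m A τ ((A-pos , _) , _) γ =
  (λ k → extremeVector k , extremeVector-∈E k γ , extremeVector-agree k , extremeVector-level k
       , extremeVector-unique k , extremeVector-extremeRay k γ) ,
  λ w w∈E T irreflexive _ agree →
    let k , ordered = agreement-ordered γ w∈E
    in  k , λ i j Tij → ordered i j (irreflexive i j Tij) (agree i j Tij)
  where open CyclePotential.Along F m τ A A-pos
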